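{- Let $G$ be a connected finite simple graph, let $<$ be a total order on $V(G)$, and let $H$ be a minimal triangulation of $G$. Let $\Pi(H)$ be the set of maximal cliques of $H$. Define the directed graph $W_H$ on vertex set $\Pi(H)$ as follows: for distinct $X, Y \in \Pi(H)$, $W_H$ has an edge from $X$ to $Y$ if and only if $X \cap Y$ is a separator of $H$ and $B(S(X,Y), Y)$ is larger than $B(S(X,Y), X)$. Then $W_H$ is acyclic.
   Context: A triangulation of $G$ is a chordal graph $H$ with $V(H)=V(G)$ and $E(G)\subseteq E(H)$; it is minimal if no triangulation $H'$ of $G$ has $E(H')$ a proper subset of $E(H)$. A vertex set $S$ is a separator of a graph if removing it leaves more than one connected component; $S$ is a minimal $a$-$b$ separator if $a,b$ lie in different components of the graph minus $S$ and no proper subset of $S$ has this property; $S$ is a minimal separator if it is a minimal $a$-$b$ separator for some vertices $a,b$. For a minimal separator $S$ of $H$, a full component of $S$ is a connected component $C$ of $H \setminus S$ with $N_H(C)=S$. For $X\in\Pi(H)$ and a minimal separator $S$ of $H$ with $S \subsetneq X$, $B(S,X)$ denotes the full component of $S$ that intersects $X$. For distinct $X,Y\in\Pi(H)$ such that $X\cap Y$ is a separator of $H$, $S(X,Y)$ denotes the inclusion-minimal minimal separator of $H$ contained in $X\cap Y$ (the paper asserts this is unique). For vertex sets $U,V\subseteq V(G)$, $U$ is larger than $V$ if $|U|>|V|$, or $|U|=|V|$ and $U$ is lexicographically larger than $V$ with respect to the order $<$. -}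

module Defs where

open import Level using (0ℓ)
open import Data.Nat using (ℕ; suc; _>_)
open import Data.Bool using (Bool; true; false)
open import Data.Fin using (Fin; toℕ)
open import Data.Fin.Subset using (Subset; _∈_; _∉_; _⊆_; _⊂_; _∩_; ∁; ⊤; ∣_∣)
open import Data.Product using (Σ; ∃; _×_; _,_)
open import Data.Sum using (_⊎_)
open import Relation.Nullary using (¬_)
open import Relation.Binary.PropositionalEquality using (_≡_; _≢_)
open import Relation.Binary using (Rel)
open import Relation.Binary.Construct.Closure.Transitive using (TransClosure)
open import Function.Definitions using (Injective)

record Graph (n : ℕ) : Set where
  field
    adj   : Fin n → Fin n → Bool
    sym   : ∀ u v → adj u v ≡ adj v u
    irref : ∀ v → adj v v ≡ false

open Graph public

E : ∀ {n} → Graph n → Fin n → Fin n → Set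
E G u v = adj G u v ≡ true

data Reach {n} (G : Graph n) (A : Subset n) : Fin n → Fin n → Set where
  here : ∀ {a} → a ∈ A → Reach G A a a
  step : ∀ {a b c} → a ∈ A → E G a b → Reach G A b c → Reach G A a c

Connected : ∀ {n} → Graph n → Set
Connected G = ∀ a b → Reach G ⊤ a b

Consec : (k : ℕ) → Fin k → Fin k → Set
Consec k i j = (suc (toℕ i) ≡ toℕ j) ⊎ (suc (toℕ i) ≡ k × toℕ j ≡ 0)

ChordlessCycle : ∀ {n} → Graph n → (k : ℕ) → (Fin k → Fin n) → Set
ChordlessCycle G k f =
  Injective _≡_ _≡_ f
  × (∀ i j → Consec k i j → E G (f i) (f j))
  × (∀ i j → E G (f i) (f j) → Consec k i j ⊎ Consec k j i)

Chordal : {n : ℕ} → Graph n → Set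
Chordal {n} G = ∀ m (f : Fin (suc (suc (suc (suc m)))) → Fin n) →
  ¬ ChordlessCycle G (suc (suc (suc (suc m)))) f

EdgeSub : ∀ {n} → Graph n → Graph n → Set
EdgeSub G H = ∀ u v → E G u v → E H u v

Triangulation : ∀ {n} → Graph n → Graph n → Set
Triangulation G H = Chordal H × EdgeSub G H

MinimalTriangulation : ∀ {n} → Graph n → Graph n → Set
MinimalTriangulation G H =
  Triangulation G H ×
  (∀ H' → Triangulation G H' → EdgeSub H' H → EdgeSub H H')

Clique : ∀ {n} → Graph n → Subset n → Set
Clique H X = ∀ u v → u ∈ X → v ∈ X → u ≢ v → E H u v

MaxClique : ∀ {n} → Graph n → Subset n → Set
MaxClique H X = Clique H X × (∀ Y → Clique H Y → X ⊆ Y → Y ≡ X)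

Component : ∀ {n} → Graph n → Subset n → Subset n → Set
Component H S C =
  (∃ λ c → c ∈ C)
  × C ⊆ ∁ S
  × (∀ a b → a ∈ C → b ∈ C → Reach H (∁ S) a b)
  × (∀ a b → a ∈ C → Reach H (∁ S) a b → b ∈ C)

Separator : ∀ {n} → Graph n → Subset n → Set
Separator H S = ∃ λ C → ∃ λ D → Component H S C × Component H S D × C ≢ D

Separates : ∀ {n} → Graph n → Subset n → Fin n → Fin n → Set
Separates H S a b = a ∉ S × b ∉ S × ¬ Reach H (∁ S) a b

MinimalABSeparator : ∀ {n} → Graph n → Fin n → Fin n → Subset n → Set
MinimalABSeparator H a b S =
  Separates H S a b × (∀ T → T ⊂ S → ¬ Separates H T a b)

MinimalSeparator : ∀ {n} → Graph n → Subset n → Set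
MinimalSeparator H S = ∃ λ a → ∃ λ b → MinimalABSeparator H a b S

-- Full component of S: component C with N_H(C) = S.
FullComponent : ∀ {n} → Graph n → Subset n → Subset n → Set
FullComponent H S C =
  Component H S C ×
  (∀ v → (v ∈ S → v ∉ C × ∃ λ u → u ∈ C × E H u v)
       × (v ∉ C → (∃ λ u → u ∈ C × E H u v) → v ∈ S))

-- C = B(S, X): S ⊊ X, C a full component of S intersecting X.
IsB : ∀ {n} → Graph n → Subset n → Subset n → Subset n → Set
IsB H S X C = MinimalSeparator H S × S ⊂ X × FullComponent H S C × (∃ λ x → x ∈ X × x ∈ C)

-- S = S(X,Y): an inclusion-minimal minimal separator of H contained in X ∩ Y.
IsSXY : ∀ {n} → Graph n → Subset n → Subset n → Subset n → Set
IsSXY H X Y S =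
  MinimalSeparator H S × S ⊆ X ∩ Y ×
  (∀ T → MinimalSeparator H T → T ⊆ X ∩ Y → ¬ (T ⊂ S))

-- Lexicographic comparison w.r.t. _≺_ (for sets of equal size): U is larger
-- than V iff the ≺-largest element of the symmetric difference lies in U.
LexGreater : ∀ {n} → Rel (Fin n) 0ℓ → Subset n → Subset n → Set
LexGreater _≺_ U V =
  ∃ λ x → x ∈ U × x ∉ V ×
    (∀ y → x ≺ y → (y ∈ U → y ∈ V) × (y ∈ V → y ∈ U))

Larger : ∀ {n} → Rel (Fin n) 0ℓ → Subset n → Subset n → Set
Larger _≺_ U V = (∣ U ∣ > ∣ V ∣) ⊎ (∣ U ∣ ≡ ∣ V ∣ × LexGreater _≺_ U V)

WEdge : ∀ {n} → Rel (Fin n) 0ℓ → Graph n → Subset n → Subset n → Set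
WEdge _≺_ H X Y =
  MaxClique H X × MaxClique H Y × X ≢ Y × Separator H (X ∩ Y) ×
  (∃ λ S → ∃ λ BY → ∃ λ BX →
     IsSXY H X Y S × IsB H S Y BY × IsB H S X BX × Larger _≺_ BY BX)

Acyclic : ∀ {n} → Rel (Subset n) 0ℓ → Set
Acyclic R = ∀ X → ¬ TransClosure R X X

{-# OPTIONS --safe #-}
module Submission where

-- Along a walk X → Y → Z of W_H the set B(S(X,Y), X) strictly grows: if S(X,Y) ⊆ S(Y,Z)
-- then the two separators coincide by minimality and B(S(Y,Z), Y) = B(S(X,Y), Y), which is
-- larger by the edge X → Y; otherwise a vertex of S(X,Y) ∖ S(Y,Z) glues B(S(X,Y), X), which
-- avoids Y, onto B(S(Y,Z), Y), making the latter strictly bigger.  A cycle would therefore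
-- make some B larger than itself.  Only the fact that members of Π(H) are cliques is used.

open import Defs
open import Level using (0ℓ)
open import Data.Nat using (ℕ; _<_)
open import Data.Nat.Properties using (<-irrefl; <-trans)
open import Data.Fin using (Fin; _≟_)
open import Data.Fin.Properties using (any?)
open import Data.Fin.Subset using (Subset; _∈_; _∉_; _⊆_; ∁)
open import Data.Fin.Subset.Properties
  using (_∈?_; ⊆-antisym; ⊆-trans; p⊂q⇒∣p∣<∣q∣; x∈∁p⇒x∉p; x∉p⇒x∈∁p; p∩q⊆p; p∩q⊆q)
open import Data.Product using (∃; _×_; _,_; proj₁; proj₂)
open import Data.Sum using (_⊎_; inj₁; inj₂)
open import Data.Empty using (⊥-elim)
open import Relation.Nullary using (¬_; yes; no)
open import Relation.Nullary.Decidable using (_×-dec_; ¬?)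
open import Relation.Binary using (Rel; IsStrictTotalOrder; tri<; tri≈; tri>)
open import Relation.Binary.Construct.Closure.Transitive using (TransClosure; [_]; _∷_)
open import Relation.Binary.PropositionalEquality using (_≡_; refl; trans; subst)
  renaming (sym to ≡-sym)

module LabelledWalks {a b ℓ r} {A : Set a} {_⟶_ : Rel A ℓ}
  {L : Set b} {_⊏_ : Rel L r}
  (⊏-irrefl : ∀ {l} → ¬ l ⊏ l) (⊏-trans : ∀ {k l m} → k ⊏ l → l ⊏ m → k ⊏ m)
  (label : ∀ {x y} → x ⟶ y → L)
  (label-increasing : ∀ {x y z} (e : x ⟶ y) (f : y ⟶ z) → label e ⊏ label f) where

  lastLabel : ∀ {x y} → TransClosure _⟶_ x y → L
  lastLabel [ e ]   = label e
  lastLabel (_ ∷ p) = lastLabel p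

  label⊏lastLabel : ∀ {x y z} (e : x ⟶ y) (p : TransClosure _⟶_ y z) → label e ⊏ lastLabel p
  label⊏lastLabel e [ f ]   = label-increasing e f
  label⊏lastLabel e (f ∷ p) = ⊏-trans (label-increasing e f) (label⊏lastLabel f p)

  lastLabel⊏label : ∀ {x y z} (p : TransClosure _⟶_ x y) (e : y ⟶ z) → lastLabel p ⊏ label e
  lastLabel⊏label [ f ]   e = label-increasing f e
  lastLabel⊏label (_ ∷ p) e = lastLabel⊏label p e

  no-cycle : (∀ {x} → ¬ x ⟶ x) → ∀ x → ¬ TransClosure _⟶_ x x
  no-cycle ⟶-irrefl x [ e ]   = ⟶-irrefl e
  no-cycle ⟶-irrefl x (e ∷ p) = ⊏-irrefl (⊏-trans (lastLabel⊏label p e) (label⊏lastLabel e p))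

⊆-or-witness : ∀ {n} (S T : Subset n) → S ⊆ T ⊎ ∃ λ x → x ∈ S × x ∉ T
⊆-or-witness S T with any? (λ x → (x ∈? S) ×-dec ¬? (x ∈? T))
... | yes witness = inj₂ witness
... | no none = inj₁ S⊆T
  where
  S⊆T : S ⊆ T
  S⊆T {x} x∈S with x ∈? T
  ... | yes x∈T = x∈T
  ... | no x∉T  = ⊥-elim (none (x , x∈S , x∉T))

module _ {n : ℕ} (H : Graph n) where

  E-sym : ∀ {u v} → E H u v → E H v u
  E-sym {u} {v} e = trans (Graph.sym H v u) e

  Reach-start : ∀ {A a b} → Reach H A a b → a ∈ A
  Reach-start (here a∈A)     = a∈A
  Reach-start (step a∈A _ _) = a∈A

  Reach-mono : ∀ {A B a b} → A ⊆ B → Reach H A a b → Reach H B a b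
  Reach-mono A⊆B (here a∈A)     = here (A⊆B a∈A)
  Reach-mono A⊆B (step a∈A e r) = step (A⊆B a∈A) e (Reach-mono A⊆B r)

  module _ {S C : Subset n} (C-comp : Component H S C) where

    component-avoids : ∀ {c} → c ∈ C → c ∉ S
    component-avoids c∈C = x∈∁p⇒x∉p (proj₁ (proj₂ C-comp) c∈C)

    component-connected : ∀ {a b} → a ∈ C → b ∈ C → Reach H (∁ S) a b
    component-connected = proj₁ (proj₂ (proj₂ C-comp)) _ _

    component-closed : ∀ {a b} → a ∈ C → Reach H (∁ S) a b → b ∈ C
    component-closed = proj₂ (proj₂ (proj₂ C-comp)) _ _

    Reach-within-component : ∀ {a b} → a ∈ C → Reach H (∁ S) a b → Reach H C a b
    Reach-within-component a∈C (here _) = here a∈C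
    Reach-within-component a∈C (step a∉S e r) =
      step a∈C e (Reach-within-component (component-closed a∈C (step a∉S e (here (Reach-start r)))) r)

    clique-outside-⊆-component : ∀ {Y w y} → Clique H Y → w ∈ Y → w ∈ C → y ∈ Y → y ∉ S → y ∈ C
    clique-outside-⊆-component {w = w} {y} Y-clique w∈Y w∈C y∈Y y∉S with y ≟ w
    ... | yes refl = w∈C
    ... | no y≢w   = component-closed w∈C
      (step (x∉p⇒x∈∁p (component-avoids w∈C)) (Y-clique w y w∈Y y∈Y (λ w≡y → y≢w (≡-sym w≡y)))
            (here (x∉p⇒x∈∁p y∉S)))

  component-unique : ∀ {S C D c} → Component H S C → Component H S D → c ∈ C → c ∈ D → C ≡ D
  component-unique C-comp D-comp c∈C c∈D =
    ⊆-antisym (λ a∈C → component-closed D-comp c∈D (component-connected C-comp c∈C a∈C))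
              (λ a∈D → component-closed C-comp c∈C (component-connected D-comp c∈D a∈D))

  component-⊆-neighbouring-component : ∀ {S T C D s u} →
    Component H S C → Component H T D → (∀ {c} → c ∈ C → c ∉ T) →
    s ∈ D → u ∈ C → E H u s → C ⊆ D
  component-⊆-neighbouring-component C-comp D-comp C∩T≡∅ s∈D u∈C us {c} c∈C =
    component-closed D-comp s∈D
      (step (x∉p⇒x∈∁p (component-avoids D-comp s∈D)) (E-sym us)
        (Reach-mono (λ v∈C → x∉p⇒x∈∁p (C∩T≡∅ v∈C))
          (Reach-within-component C-comp u∈C (component-connected C-comp u∈C c∈C))))

  SXY-unique-below : ∀ {X Y S T} → IsSXY H X Y T → MinimalSeparator H S → S ⊆ T → T ≡ S
  SXY-unique-below {S = S} (_ , T⊆X∩Y , T-minimal) S-minsep S⊆T = ⊆-antisym T⊆S S⊆T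
    where
    T⊆S : _ ⊆ S
    T⊆S {x} x∈T with x ∈? S
    ... | yes x∈S = x∈S
    ... | no x∉S  = ⊥-elim (T-minimal S S-minsep (⊆-trans S⊆T T⊆X∩Y) (S⊆T , x , x∈T , x∉S))

module Order {n : ℕ} (_≺_ : Rel (Fin n) 0ℓ) (≺-order : IsStrictTotalOrder _≡_ _≺_) where
  open IsStrictTotalOrder ≺-order using (compare) renaming (trans to ≺-trans)

  Larger-irrefl : ∀ {U} → ¬ Larger _≺_ U U
  Larger-irrefl (inj₁ ∣U∣<∣U∣)              = <-irrefl refl ∣U∣<∣U∣
  Larger-irrefl (inj₂ (_ , _ , x∈U , x∉U , _)) = x∉U x∈U

  private
    agree : ∀ {U V W : Subset n} {z} → (z ∈ U → z ∈ V) × (z ∈ V → z ∈ U) → (z ∈ V → z ∈ W) × (z ∈ W → z ∈ V) →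
            (z ∈ U → z ∈ W) × (z ∈ W → z ∈ U)
    agree (U→V , V→U) (V→W , W→V) = (λ z∈U → V→W (U→V z∈U)) , (λ z∈W → V→U (W→V z∈W))

  LexGreater-trans : ∀ {U V W} → LexGreater _≺_ U V → LexGreater _≺_ V W → LexGreater _≺_ U W
  LexGreater-trans (x , x∈U , x∉V , above-x) (y , y∈V , y∉W , above-y) with compare x y
  ... | tri< x≺y _ _ = y , proj₂ (above-x y x≺y) y∈V , y∉W ,
        λ z y≺z → agree (above-x z (≺-trans x≺y y≺z)) (above-y z y≺z)
  ... | tri≈ _ refl _ = ⊥-elim (x∉V y∈V)
  ... | tri> _ _ y≺x = x , x∈U , (λ x∈W → x∉V (proj₂ (above-y x y≺x) x∈W)) ,
        λ z x≺z → agree (above-x z x≺z) (above-y z (≺-trans y≺x x≺z))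

  Larger-trans : ∀ {U V W} → Larger _≺_ V W → Larger _≺_ U V → Larger _≺_ U W
  Larger-trans (inj₁ ∣W∣<∣V∣) (inj₁ ∣V∣<∣U∣)     = inj₁ (<-trans ∣W∣<∣V∣ ∣V∣<∣U∣)
  Larger-trans (inj₁ ∣W∣<∣V∣) (inj₂ (∣U∣≡∣V∣ , _)) = inj₁ (subst (_ <_) (≡-sym ∣U∣≡∣V∣) ∣W∣<∣V∣)
  Larger-trans (inj₂ (∣V∣≡∣W∣ , _)) (inj₁ ∣V∣<∣U∣) = inj₁ (subst (_< _) ∣V∣≡∣W∣ ∣V∣<∣U∣)
  Larger-trans (inj₂ (∣V∣≡∣W∣ , V>W)) (inj₂ (∣U∣≡∣V∣ , U>V)) =
    inj₂ (trans ∣U∣≡∣V∣ ∣V∣≡∣W∣ , LexGreater-trans U>V V>W)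

  module _ (H : Graph n) where

    sourceB : ∀ {X Y} → WEdge _≺_ H X Y → Subset n
    sourceB (_ , _ , _ , _ , _ , _ , BX , _) = BX

    -- B(S(X,Y), X) avoids Y: otherwise it would be the component B(S(X,Y), Y), which is strictly larger.
    sourceB-avoids-target : ∀ {X Y} (e : WEdge _≺_ H X Y) → ∀ {y} → y ∈ sourceB e → y ∉ Y
    sourceB-avoids-target
      (_ , (Y-clique , _) , _ , _ , _ , BY , BX , _ , (_ , _ , (BY-comp , _) , w , w∈Y , w∈BY) ,
       (_ , _ , (BX-comp , _) , _) , BY>BX) y∈BX y∈Y =
      Larger-irrefl (subst (λ C → Larger _≺_ C BX)
        (component-unique H BY-comp BX-comp
          (clique-outside-⊆-component H BY-comp Y-clique w∈Y w∈BY y∈Y (component-avoids H BX-comp y∈BX))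
          y∈BX)
        BY>BX)

    sourceB-increasing : ∀ {X Y Z} (e : WEdge _≺_ H X Y) (f : WEdge _≺_ H Y Z) →
                         Larger _≺_ (sourceB f) (sourceB e)
    sourceB-increasing {X} {Y} {Z}
      e@(_ , (Y-clique , _) , _ , _ , S , B₁ , B₀ , (S-minsep , S⊆X∩Y , _) ,
         (_ , _ , (B₁-comp , _) , w₁ , w₁∈Y , w₁∈B₁) , (_ , _ , (B₀-comp , B₀-full) , _) , B₁>B₀)
      (_ , _ , _ , _ , T , _ , B₂ , T-SXY@(_ , T⊆Y∩Z , _) , _ ,
         (_ , (_ , y , y∈Y , y∉T) , (B₂-comp , _) , w₂ , w₂∈Y , w₂∈B₂) , _)
      with ⊆-or-witness S T
    ... | inj₂ (s , s∈S , s∉T) = inj₁ (p⊂q⇒∣p∣<∣q∣ (B₀⊆B₂ , s , s∈B₂ , s∉B₀))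
      where
      s∈B₂ : s ∈ B₂
      s∈B₂ = clique-outside-⊆-component H B₂-comp Y-clique w₂∈Y w₂∈B₂ (p∩q⊆q X Y (S⊆X∩Y s∈S)) s∉T
      s∉B₀ : s ∉ B₀
      s∉B₀ s∈B₀ = component-avoids H B₀-comp s∈B₀ s∈S
      B₀⊆B₂ : B₀ ⊆ B₂
      B₀⊆B₂ with proj₂ (proj₁ (B₀-full s) s∈S)
      ... | u , u∈B₀ , us = component-⊆-neighbouring-component H B₀-comp B₂-comp
            (λ c∈B₀ c∈T → sourceB-avoids-target e c∈B₀ (p∩q⊆p Y Z (T⊆Y∩Z c∈T))) s∈B₂ u∈B₀ us
    ... | inj₁ S⊆T = subst (λ C → Larger _≺_ C B₀) (≡-sym B₂≡B₁) B₁>B₀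
      where
      T≡S : T ≡ S
      T≡S = SXY-unique-below H T-SXY S-minsep S⊆T
      B₂≡B₁ : B₂ ≡ B₁
      B₂≡B₁ = component-unique H (subst (λ R → Component H R B₂) T≡S B₂-comp) B₁-comp
        (clique-outside-⊆-component H B₂-comp Y-clique w₂∈Y w₂∈B₂ y∈Y y∉T)
        (clique-outside-⊆-component H B₁-comp Y-clique w₁∈Y w₁∈B₁ y∈Y (λ y∈S → y∉T (S⊆T y∈S)))

    WEdge-irrefl : ∀ {X} → ¬ WEdge _≺_ H X X
    WEdge-irrefl (_ , _ , X≢X , _) = X≢X refl

    W-acyclic : Acyclic (WEdge _≺_ H)
    W-acyclic = LabelledWalks.no-cycle {_⊏_ = λ U V → Larger _≺_ V U}
      Larger-irrefl Larger-trans sourceB sourceB-increasing WEdge-irrefl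

mainTheorem1 : (n : ℕ) (G : Graph n) → Connected G →
    (_≺_ : Rel (Fin n) 0ℓ) → IsStrictTotalOrder _≡_ _≺_ →
    (H : Graph n) → MinimalTriangulation G H →
    Acyclic (WEdge _≺_ H)
mainTheorem1 n G _ _≺_ ≺-order H _ = Order.W-acyclic _≺_ ≺-order H
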